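{- Let $q$ be a prime power and $n,t$ positive integers, and let $B$ be a minimal blocking set with respect to the hyperplanes of $\mathrm{PG}(n-1,q^t)$. Then there exists a minimal blocking set $B'$ with respect to $(nt-t-1)$-dimensional subspaces of $\mathrm{PG}(nt-1,q)$ such that $B=\mathcal{B}(B')$.
   Context: Field reduction: each point of $\mathrm{PG}(n-1,q^t)$ corresponds to a $(t-1)$-dimensional subspace of $\mathrm{PG}(nt-1,q)$ (via $\mathbb{F}_{q^t}^n\cong\mathbb{F}_q^{nt}$), and these form the Desarguesian $(t-1)$-spread $\mathcal{D}$ of $\mathrm{PG}(nt-1,q)$. For $U\subseteq\mathrm{PG}(nt-1,q)$, $\mathcal{B}(U)$ is the set of elements of $\mathcal{D}$ meeting $U$, identified with the corresponding points of $\mathrm{PG}(n-1,q^t)$. A blocking set with respect to $j$-spaces is a point set meeting every $j$-dimensional subspace; it is minimal if no proper subset is one. -}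

module Defs where

open import Level using (0ℓ)
open import Data.Nat using (ℕ; zero; suc; _≤_; _^_)
open import Data.Nat.Primality using (Prime)
open import Data.Fin using (Fin; zero; suc)
open import Data.Product using (Σ; ∃; _×_; _,_)
open import Relation.Binary.PropositionalEquality using (_≡_; _≢_)
open import Relation.Nullary using (¬_)
open import Algebra.Structures using (IsCommutativeRing)

IsPrimePower : ℕ → Set
IsPrimePower q = ∃ λ p → ∃ λ k → Prime p × 1 ≤ k × q ≡ p ^ k

record Field : Set₁ where
  infixl 6 _+_
  infixl 7 _*_
  field
    Carrier : Set
    _+_ _*_ : Carrier → Carrier → Carrier
    -_      : Carrier → Carrier
    0# 1#   : Carrier
    isCommutativeRing : IsCommutativeRing _≡_ _+_ _*_ -_ 0# 1#
    0≢1     : 0# ≢ 1#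
    inverse : ∀ x → x ≢ 0# → ∃ λ y → x * y ≡ 1#

open Field public using (Carrier)

record Embedding (F K : Field) : Set where
  private
    module F = Field F
    module K = Field K
  field
    ι   : F.Carrier → K.Carrier
    ι-1 : ι F.1# ≡ K.1#
    ι-+ : ∀ a b → ι (a F.+ b) ≡ ι a K.+ ι b
    ι-* : ∀ a b → ι (a F.* b) ≡ ι a K.* ι b

-- Geometry of the vector space K^n (= F_{q^t}^n), which is viewed
-- either as a K-vector space (PG(n-1,q^t)) or, through an embedding of
-- F into K, as an F-vector space of dimension nt (PG(nt-1,q)).
module Geometry (K : Field) (n : ℕ) where
  open Field K hiding (Carrier)

  V : Set
  V = Fin n → Carrier K

  _≐_ : V → V → Set
  u ≐ v = ∀ i → u i ≡ v i

  zeroV : V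
  zeroV _ = 0#

  _+V_ : V → V → V
  (u +V v) i = u i + v i

  Nonzero : V → Set
  Nonzero v = ∃ λ i → v i ≢ 0#

  _·K_ : Carrier K → V → V
  (a ·K v) i = a * v i

  module Over {S : Set} (0s : S) (_·_ : S → V → V) where

    lincomb : ∀ {k} → (Fin k → S) → (Fin k → V) → V
    lincomb {zero}  c w = zeroV
    lincomb {suc k} c w = (c zero · w zero) +V lincomb (λ i → c (suc i)) (λ i → w (suc i))

    Independent : ∀ {k} → (Fin k → V) → Set
    Independent w = ∀ c → lincomb c w ≐ zeroV → ∀ i → c i ≡ 0s

    InSpan : ∀ {k} → (Fin k → V) → V → Set
    InSpan w v = ∃ λ c → v ≐ lincomb c w

    -- A set of projective points, represented by the set of all
    -- (nonzero) vector representatives of its points.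
    IsPointSet : (V → Set) → Set
    IsPointSet P = (∀ u v → u ≐ v → P u → P v)
                 × (∀ v → P v → Nonzero v)
                 × (∀ s v → s ≢ 0s → P v → P (s · v))

    -- P meets every vector subspace of dimension k
    -- (= every projective (k-1)-dimensional subspace), each subspace
    -- being given as the span of k linearly independent vectors.
    Blocking : ℕ → (V → Set) → Set
    Blocking k P = ∀ (w : Fin k → V) → Independent w → ∃ λ v → P v × InSpan w v

    MinimalBlocking : ℕ → (V → Set) → Set₁
    MinimalBlocking k P = IsPointSet P × Blocking k P
      × (∀ (P' : V → Set) → IsPointSet P' → (∀ v → P' v → P v)
           → (∃ λ v → P v × ¬ P' v) → ¬ Blocking k P')

  module OverK = Over 0# _·K_

  module OverF (F : Field) (e : Embedding F K) where
    open Embedding e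
    _·F_ : Carrier F → V → V
    (a ·F v) i = ι a * v i
    open Over (Field.0# F) _·F_ public

  -- 𝓑(U): points ⟨v⟩_K of PG(n-1,K) whose spread element
  -- {λ v : λ ∈ K} meets U.
  𝓑 : (V → Set) → V → Set
  𝓑 U v = Nonzero v × ∃ λ a → a ≢ 0# × U (a ·K v)

-- The
-- geometric core is HyperplanesBlockSubspaces: a K-point set meeting every
-- hyperplane meets every F-subspace of dimension nt - t (a dimension count
-- done by pigeonhole).  Since B need not be decidable, DecidableCore picks
-- a decidable blocking subset; MinimalSubset prunes it greedily to a
-- minimal one, B'.  Finally 𝓑(B') ⊆ B blocks hyperplanes, so it equals B
-- by minimality of B.
module Submission where

open import Defs
import Data.Nat as ℕ
open ℕ using (ℕ; zero; suc; _≤_; _<_; z≤n; s≤s)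
import Data.Nat.Properties as ℕP
open import Data.Nat.Primality using (prime⇒nonTrivial)
open import Data.Fin
  using (Fin; zero; suc; punchIn; punchOut; _↑ˡ_; _↑ʳ_; splitAt; join; combine; remQuot; finToFun; funToFin)
open import Data.Sum using (inj₁; inj₂; [_,_]′)
import Data.Fin.Properties as FinP
open import Data.Product using (Σ; ∃; ∃₂; _×_; _,_; proj₁; proj₂)
open import Data.Empty using (⊥-elim)
open import Data.Maybe using (Maybe; just; nothing)
open import Data.List using (List; []; _∷_; allFin)
import Data.List
open import Data.List.Membership.Propositional using (_∈_)
open import Data.List.Membership.Propositional.Properties using (∈-allFin; ∈-map⁺)
open import Data.List.Relation.Unary.Any using (here; there)
open import Function using (_∘_)
open import Function.Bundles using (_↔_; _⇔_; mk⇔; Inverse)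
open import Relation.Nullary using (¬_; Dec; yes; no)
open import Relation.Nullary.Decidable using (_×-dec_; _→-dec_; ¬?; decidable-stable)
open import Relation.Binary.Definitions using (tri<; tri≈; tri>)
open import Relation.Binary.PropositionalEquality
open import Algebra.Bundles using (CommutativeRing)
open import Tactic.RingSolver.Core.AlmostCommutativeRing using (fromCommutativeRing)

-- Vectors over a finite field are finite only up
-- to pointwise equality (there is no function extensionality), hence the
-- enumeration is taken modulo _≈_.
record Finite : Set₁ where
  field
    Elt           : Set
    _≈_           : Elt → Elt → Set
    ≈-refl        : ∀ {x} → x ≈ x
    ≈-sym         : ∀ {x y} → x ≈ y → y ≈ x
    ≈-trans       : ∀ {x y z} → x ≈ y → y ≈ z → x ≈ z
    size          : ℕ
    encode        : Elt → Fin size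
    decode        : Fin size → Elt
    encode-decode : ∀ i → encode (decode i) ≡ i
    decode-encode : ∀ x → decode (encode x) ≈ x
    encode-cong   : ∀ {x y} → x ≈ y → encode x ≡ encode y

  encode-injective : ∀ {x y} → encode x ≡ encode y → x ≈ y
  encode-injective {x} {y} p =
    ≈-trans (≈-sym (decode-encode x)) (subst (λ i → decode i ≈ y) (sym p) (decode-encode y))

  decode-injective : ∀ {i j} → decode i ≈ decode j → i ≡ j
  decode-injective {i} {j} p = trans (sym (encode-decode i)) (trans (encode-cong p) (encode-decode j))

  _≈?_ : ∀ x y → Dec (x ≈ y)
  x ≈? y with encode x FinP.≟ encode y
  ... | yes p = yes (encode-injective p)
  ... | no ¬p = no (¬p ∘ encode-cong)

  all? : {P : Elt → Set} → (∀ x → Dec (P x)) → (∀ {x y} → x ≈ y → P x → P y) → Dec (∀ x → P x)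
  all? P? resp with FinP.all? (P? ∘ decode)
  ... | yes h = yes (λ x → resp (decode-encode x) (h (encode x)))
  ... | no ¬h = no (λ h → ¬h (h ∘ decode))

  any? : {P : Elt → Set} → (∀ x → Dec (P x)) → (∀ {x y} → x ≈ y → P x → P y) → Dec (∃ P)
  any? P? resp with FinP.any? (P? ∘ decode)
  ... | yes (i , h) = yes (decode i , h)
  ... | no ¬h = no (λ { (x , px) → ¬h (encode x , resp (≈-sym (decode-encode x)) px) })

open Finite using (Elt; size; encode; decode; decode-encode)

Collision : (A B : Finite) → (Elt A → Elt B) → Set
Collision A B f = ∃₂ λ x y → ¬ Finite._≈_ A x y × Finite._≈_ B (f x) (f y)

pigeonhole : (A B : Finite) → size B < size A → (f : Elt A → Elt B) → Collision A B f
pigeonhole A B lt f with FinP.pigeonhole lt (encode B ∘ f ∘ decode A)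
... | i , j , i<j , eq =
  decode A i , decode A j , FinP.<⇒≢ i<j ∘ Finite.decode-injective A , Finite.encode-injective B eq

pigeonhole-missing-Fin : ∀ {a b} → b ≤ a → (h : Fin a → Fin b) → (y : Fin b) → (∀ i → h i ≢ y) →
                         ∃₂ λ i j → i ≢ j × h i ≡ h j
pigeonhole-missing-Fin {b = suc _} le h y miss
  with FinP.pigeonhole le (λ i → punchOut (miss i ∘ sym))
... | i , j , i<j , eq = i , j , FinP.<⇒≢ i<j , FinP.punchOut-injective (miss i ∘ sym) (miss j ∘ sym) eq

pigeonhole-missing : (A B : Finite) → size B ≤ size A → (f : Elt A → Elt B) →
                     (y : Elt B) → (∀ x → ¬ Finite._≈_ B (f x) y) → Collision A B f
pigeonhole-missing A B le f y miss
  with pigeonhole-missing-Fin le (encode B ∘ f ∘ decode A) (encode B y)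
         (λ i p → miss (decode A i) (Finite.encode-injective B p))
... | i , j , i≢j , eq = decode A i , decode A j , i≢j ∘ Finite.decode-injective A , Finite.encode-injective B eq

finite-↔ : {A : Set} {n : ℕ} → A ↔ Fin n → Finite
finite-↔ {A} {n} A↔n = record
  { Elt = A ; _≈_ = _≡_ ; ≈-refl = refl ; ≈-sym = sym ; ≈-trans = trans
  ; size = n ; encode = Inverse.to A↔n ; decode = Inverse.from A↔n
  ; encode-decode = λ i → Inverse.inverseˡ A↔n refl
  ; decode-encode = λ x → Inverse.inverseʳ A↔n refl
  ; encode-cong = cong (Inverse.to A↔n) }

funToFin-cong : ∀ {m n} (f g : Fin m → Fin n) → (∀ i → f i ≡ g i) → funToFin f ≡ funToFin g
funToFin-cong {zero}  f g p = refl
funToFin-cong {suc m} f g p = cong₂ combine (p zero) (funToFin-cong (f ∘ suc) (g ∘ suc) (p ∘ suc))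

finite-^ : ℕ → Finite → Finite
finite-^ k S = record
  { Elt = Fin k → Elt S ; _≈_ = λ f g → ∀ i → f i ≈ g i
  ; ≈-refl = λ i → ≈-refl ; ≈-sym = λ p i → ≈-sym (p i) ; ≈-trans = λ p r i → ≈-trans (p i) (r i)
  ; size = size S ℕ.^ k
  ; encode = λ f → funToFin (encode S ∘ f)
  ; decode = λ c i → decode S (finToFun c i)
  ; encode-decode = λ c → trans (funToFin-cong {k} _ _ (λ i → encode-decode (finToFun c i)))
                                (FinP.funToFin-finToFin {k} c)
  ; decode-encode = λ f i → subst (λ z → decode S z ≈ f i)
                                   (sym (FinP.finToFun-funToFin (encode S ∘ f) i)) (decode-encode S (f i))
  ; encode-cong = λ p → funToFin-cong _ _ (λ i → encode-cong (p i)) }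
  where open Finite S using (_≈_; ≈-refl; ≈-sym; ≈-trans; encode-decode; encode-cong)

finite-× : Finite → Finite → Finite
finite-× A B = record
  { Elt = Elt A × Elt B ; _≈_ = λ { (a , b) (a' , b') → A._≈_ a a' × B._≈_ b b' }
  ; ≈-refl = A.≈-refl , B.≈-refl ; ≈-sym = λ { (p , r) → A.≈-sym p , B.≈-sym r }
  ; ≈-trans = λ { (p , r) (p' , r') → A.≈-trans p p' , B.≈-trans r r' }
  ; size = size A ℕ.* size B
  ; encode = λ { (a , b) → combine (encode A a) (encode B b) }
  ; decode = λ c → let (i , j) = remQuot {size A} (size B) c in decode A i , decode B j
  ; encode-decode = λ c → trans (cong₂ combine (A.encode-decode _) (B.encode-decode _))
                                (FinP.combine-remQuot {size A} (size B) c)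
  ; decode-encode = λ { (a , b) →
      subst (λ z → A._≈_ (decode A (proj₁ z)) a × B._≈_ (decode B (proj₂ z)) b)
            (sym (FinP.remQuot-combine {size A} {size B} (encode A a) (encode B b)))
            (decode-encode A a , decode-encode B b) }
  ; encode-cong = λ { (p , r) → cong₂ combine (A.encode-cong p) (B.encode-cong r) } }
  where
  module A = Finite A
  module B = Finite B

module FieldFacts (K : Field) where
  open Field K hiding (Carrier)

  commutativeRing : CommutativeRing _ _
  commutativeRing = record { isCommutativeRing = isCommutativeRing }

  open CommutativeRing commutativeRing public
    using ( +-identityˡ; +-identityʳ; zeroˡ; zeroʳ; *-identityˡ; *-identityʳ; +-comm; +-assoc
          ; *-comm; *-assoc; distribˡ; distribʳ; -‿inverseʳ; ring; semiring; +-group)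
  open import Algebra.Properties.Ring ring public using (-‿distribˡ-*; -‿distribʳ-*; [y-z]x≈yx-zx)
  open import Algebra.Properties.Group +-group public
    using (x∙y⁻¹≈ε⇒x≈y; x≈y⇒x∙y⁻¹≈ε; inverseʳ-unique; identityʳ-unique; ∙-cancelˡ)
  open import Algebra.Properties.Semiring.Sum semiring public
    using (sum; sum-cong-≗; ∑-distrib-+; *-distribˡ-sum; *-distribʳ-sum; sum-replicate-zero)

  inv : ∀ a → a ≢ 0# → Carrier K
  inv a a≢0 = proj₁ (inverse a a≢0)

  inv-r : ∀ a (a≢0 : a ≢ 0#) → a * inv a a≢0 ≡ 1#
  inv-r a a≢0 = proj₂ (inverse a a≢0)

  inv-l : ∀ a (a≢0 : a ≢ 0#) → inv a a≢0 * a ≡ 1#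
  inv-l a a≢0 = trans (*-comm _ a) (inv-r a a≢0)

  inv-cancel : ∀ a (a≢0 : a ≢ 0#) x → inv a a≢0 * (a * x) ≡ x
  inv-cancel a a≢0 x = trans (sym (*-assoc _ a x)) (trans (cong (_* x) (inv-l a a≢0)) (*-identityˡ x))

  no-zero-divisors : ∀ {a b} → a * b ≡ 0# → a ≢ 0# → b ≡ 0#
  no-zero-divisors {a} {b} ab≡0 a≢0 = begin
    b                  ≡⟨ sym (inv-cancel a a≢0 b) ⟩
    inv a a≢0 * (a * b) ≡⟨ cong (inv a a≢0 *_) ab≡0 ⟩
    inv a a≢0 * 0#      ≡⟨ zeroʳ _ ⟩
    0#                 ∎
    where open ≡-Reasoning

  *-≢0 : ∀ {a b} → a ≢ 0# → b ≢ 0# → a * b ≢ 0#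
  *-≢0 a≢0 b≢0 ab≡0 = b≢0 (no-zero-divisors ab≡0 a≢0)

  1≢0 : 1# ≢ 0#
  1≢0 = 0≢1 ∘ sym

  inv-≢0 : ∀ a (a≢0 : a ≢ 0#) → inv a a≢0 ≢ 0#
  inv-≢0 a a≢0 p = 1≢0 (trans (sym (inv-r a a≢0)) (trans (cong (a *_) p) (zeroʳ a)))

  sub≡0⇒≡ : ∀ {x y} → x + - y ≡ 0# → x ≡ y
  sub≡0⇒≡ = x∙y⁻¹≈ε⇒x≈y _ _

  ≡⇒sub≡0 : ∀ {x y} → x ≡ y → x + - y ≡ 0#
  ≡⇒sub≡0 = x≈y⇒x∙y⁻¹≈ε

  neg-unique : ∀ {x y} → x + y ≡ 0# → y ≡ - x
  neg-unique = inverseʳ-unique _ _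

  -- Moving terms across an equation: a + b = c + d implies a - c = d - b.
  -- (The rearrangements treat - b and - c as atoms: over an abstract ring
  -- the solver cannot cancel, so cancellation is done by hand.)
  transpose : ∀ {a b c d} → a + b ≡ c + d → a + - c ≡ d + - b
  transpose {a} {b} {c} {d} eq = begin
    a + - c               ≡⟨ sym (trans (cong ((a + - c) +_) (-‿inverseʳ b)) (+-identityʳ _)) ⟩
    (a + - c) + (b + - b) ≡⟨ solve 4 (λ a b b' c' → ((a ⊕ c') ⊕ (b ⊕ b')) ⊜ ((a ⊕ b) ⊕ (b' ⊕ c')))
                                   refl a b (- b) (- c) ⟩
    (a + b) + (- b + - c) ≡⟨ cong (_+ (- b + - c)) eq ⟩
    (c + d) + (- b + - c) ≡⟨ solve 4 (λ c d b' c' → ((c ⊕ d) ⊕ (b' ⊕ c')) ⊜ ((d ⊕ b') ⊕ (c ⊕ c')))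
                                   refl c d (- b) (- c) ⟩
    (d + - b) + (c + - c) ≡⟨ trans (cong ((d + - b) +_) (-‿inverseʳ c)) (+-identityʳ _) ⟩
    d + - b               ∎
    where
    open ≡-Reasoning
    open import Tactic.RingSolver.NonReflective (fromCommutativeRing commutativeRing (λ _ → nothing))

  sum-zero : ∀ {k} (f : Fin k → Carrier K) → (∀ j → f j ≡ 0#) → sum f ≡ 0#
  sum-zero {k} f f≡0 = trans (sum-cong-≗ f≡0) (sum-replicate-zero k)

  sum-neg : ∀ {k} (f : Fin k → Carrier K) → sum (λ j → - f j) ≡ - sum f
  sum-neg f = neg-unique (trans (sym (∑-distrib-+ f (λ j → - f j))) (sum-zero _ (-‿inverseʳ ∘ f)))

  sum-sub : ∀ {k} (f g : Fin k → Carrier K) → sum f + - sum g ≡ sum (λ j → f j + - g j)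
  sum-sub f g = trans (cong (sum f +_) (sym (sum-neg g))) (sym (∑-distrib-+ f (λ j → - g j)))

  sum-single : ∀ {k} (f : Fin k → Carrier K) j → (∀ j' → j' ≢ j → f j' ≡ 0#) → sum f ≡ f j
  sum-single f zero    off = trans (cong (f zero +_) (sum-zero _ (λ j' → off (suc j') λ ()))) (+-identityʳ _)
  sum-single f (suc j) off =
    trans (cong₂ _+_ (off zero λ ()) (sum-single (f ∘ suc) j (λ j' ne → off (suc j') (ne ∘ FinP.suc-injective))))
          (+-identityˡ _)

module EmbeddingFacts {F K : Field} (e : Embedding F K) where
  open Embedding e
  private
    module F = Field F
    module K = Field K
    module FF = FieldFacts F
    module KF = FieldFacts K

  ι-0 : ι F.0# ≡ K.0#
  ι-0 = KF.identityʳ-unique (ι F.0#) (ι F.0#) (trans (sym (ι-+ F.0# F.0#)) (cong ι (FF.+-identityʳ F.0#)))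

  ι-neg : ∀ a → ι (F.- a) ≡ K.- ι a
  ι-neg a = KF.neg-unique (trans (sym (ι-+ a (F.- a))) (trans (cong ι (FF.-‿inverseʳ a)) ι-0))

  ι-≢0 : ∀ {a} → a ≢ F.0# → ι a ≢ K.0#
  ι-≢0 {a} a≢0 ιa≡0 = KF.1≢0 (begin
    K.1#                 ≡⟨ sym ι-1 ⟩
    ι F.1#               ≡⟨ cong ι (sym (FF.inv-r a a≢0)) ⟩
    ι (a F.* FF.inv a a≢0) ≡⟨ ι-* a _ ⟩
    ι a K.* ι (FF.inv a a≢0) ≡⟨ cong (K._* ι (FF.inv a a≢0)) ιa≡0 ⟩
    K.0# K.* ι (FF.inv a a≢0) ≡⟨ KF.zeroˡ _ ⟩
    K.0#                 ∎)
    where open ≡-Reasoning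

module Vectors (K : Field) (n : ℕ) where
  open Geometry K n public
  open Field K hiding (Carrier)
  open FieldFacts K

  ≐-refl : ∀ {u} → u ≐ u
  ≐-refl i = refl

  ≐-sym : ∀ {u v} → u ≐ v → v ≐ u
  ≐-sym p i = sym (p i)

  ≐-trans : ∀ {u v w} → u ≐ v → v ≐ w → u ≐ w
  ≐-trans p r i = trans (p i) (r i)

  -- Linear algebra valid for every scalar action (s · v) i = σ s * v i;
  -- used both for K itself and for a subfield F acting through ι.
  module Linear {S : Set} (0s : S) (σ : S → Carrier K)
                (_·_ : S → V → V) (·-def : ∀ s v i → (s · v) i ≡ σ s * v i) where
    open Over 0s _·_ public

    lincomb-coord : ∀ {k} (c : Fin k → S) w i → lincomb c w i ≡ sum (λ j → σ (c j) * w j i)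
    lincomb-coord {zero}  c w i = refl
    lincomb-coord {suc k} c w i = cong₂ _+_ (·-def (c zero) (w zero) i) (lincomb-coord (c ∘ suc) (w ∘ suc) i)

    lincomb-cong : ∀ {k} {c c' : Fin k → S} {w w' : Fin k → V} → (∀ j → c j ≡ c' j) → (∀ j → w j ≐ w' j) →
                   lincomb c w ≐ lincomb c' w'
    lincomb-cong {c = c} {c'} {w} {w'} c≡c' w≐w' i = begin
      lincomb c w i                       ≡⟨ lincomb-coord c w i ⟩
      sum (λ j → σ (c j) * w j i)         ≡⟨ sum-cong-≗ (λ j → cong₂ (λ a b → σ a * b) (c≡c' j) (w≐w' j i)) ⟩
      sum (λ j → σ (c' j) * w' j i)       ≡⟨ lincomb-coord c' w' i ⟨
      lincomb c' w' i                     ∎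
      where open ≡-Reasoning

    independent-cong : ∀ {k} {w w' : Fin k → V} → (∀ j → w j ≐ w' j) → Independent w → Independent w'
    independent-cong w≐w' ind c eq = ind c (≐-trans (lincomb-cong (λ _ → refl) w≐w') eq)

    inSpan-cong : ∀ {k} {w w' : Fin k → V} → (∀ j → w j ≐ w' j) → ∀ {v} → InSpan w v → InSpan w' v
    inSpan-cong w≐w' (c , eq) = c , ≐-trans eq (lincomb-cong (λ _ → refl) w≐w')

    inSpan-resp : ∀ {k} (w : Fin k → V) {u v} → u ≐ v → InSpan w u → InSpan w v
    inSpan-resp w u≐v (c , eq) = c , ≐-trans (≐-sym u≐v) eq

    lincomb-++ : ∀ a {a'} (c : Fin (a ℕ.+ a') → S) (w : Fin (a ℕ.+ a') → V) →
      lincomb c w ≐ (lincomb (c ∘ (_↑ˡ a')) (w ∘ (_↑ˡ a')) +V lincomb (c ∘ (a ↑ʳ_)) (w ∘ (a ↑ʳ_)))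
    lincomb-++ zero    c w i = sym (+-identityˡ _)
    lincomb-++ (suc a) c w i =
      trans (cong ((c zero · w zero) i +_) (lincomb-++ a (c ∘ suc) (w ∘ suc) i)) (sym (+-assoc _ _ _))

    lincomb-closed : (Q : V → Set) → Q zeroV → (∀ u v → Q u → Q v → Q (u +V v)) →
                     (∀ s v → Q v → Q (s · v)) →
                     ∀ {k} (c : Fin k → S) (w : Fin k → V) → (∀ j → Q (w j)) → Q (lincomb c w)
    lincomb-closed Q Q0 Q+ Q· {zero}  c w Qw = Q0
    lincomb-closed Q Q0 Q+ Q· {suc k} c w Qw =
      Q+ _ _ (Q· (c zero) (w zero) (Qw zero)) (lincomb-closed Q Q0 Q+ Q· (c ∘ suc) (w ∘ suc) (Qw ∘ suc))

    blocking-mono : ∀ k {P Q : V → Set} → (∀ v → P v → Q v) → Blocking k P → Blocking k Q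
    blocking-mono k P⊆Q blkP w ind = let (v , Pv , v∈w) = blkP w ind in v , P⊆Q v Pv , v∈w

  module LinearK = Linear 0# (λ a → a) _·K_ (λ _ _ _ → refl)

  module LinearF {F : Field} (e : Embedding F K) where
    open Embedding e
    open EmbeddingFacts e
    private module F = Field F
    open Linear F.0# ι (OverF._·F_ F e) (λ _ _ _ → refl) public

    lincomb-sub : ∀ {k} (c c' : Fin k → Carrier F) (w : Fin k → V) i →
                  lincomb c w i + - lincomb c' w i ≡ lincomb (λ j → c j F.+ F.- c' j) w i
    lincomb-sub {k} c c' w i = begin
      lincomb c w i + - lincomb c' w i
        ≡⟨ cong₂ (λ a b → a + - b) (lincomb-coord c w i) (lincomb-coord c' w i) ⟩
      sum (λ j → ι (c j) * w j i) + - sum (λ j → ι (c' j) * w j i)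
        ≡⟨ sum-sub (λ j → ι (c j) * w j i) (λ j → ι (c' j) * w j i) ⟩
      sum (λ j → ι (c j) * w j i + - (ι (c' j) * w j i))
        ≡⟨ sum-cong-≗ {k} (λ j → sym ([y-z]x≈yx-zx (w j i) _ _)) ⟩
      sum (λ j → (ι (c j) + - ι (c' j)) * w j i)
        ≡⟨ sum-cong-≗ {k} (λ j → cong (_* w j i) (sym ι-sub)) ⟩
      sum (λ j → ι (c j F.+ F.- c' j) * w j i)
        ≡⟨ lincomb-coord _ w i ⟨
      lincomb (λ j → c j F.+ F.- c' j) w i
        ∎
      where
      open ≡-Reasoning
      ι-sub : ∀ {a b} → ι (a F.+ F.- b) ≡ ι a + - ι b
      ι-sub {a} {b} = trans (ι-+ a (F.- b)) (cong (ι a +_) (ι-neg b))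

    K-points⇒F-points : ∀ {P} → LinearK.IsPointSet P → IsPointSet P
    K-points⇒F-points (P-resp , P-nonzero , P-scale) =
      P-resp , P-nonzero , λ s v s≢0 → P-scale (ι s) v (ι-≢0 s≢0)

  𝓑-points : ∀ {U} → (∀ {u v} → u ≐ v → U u → U v) → LinearK.IsPointSet (𝓑 U)
  𝓑-points U-resp =
    (λ u v u≐v → λ { ((i , u_i≢0) , a , a≢0 , Uau) →
        (i , u_i≢0 ∘ trans (u≐v i)) , a , a≢0 , U-resp (λ j → cong (a *_) (u≐v j)) Uau }) ,
    (λ v → proj₁) ,
    (λ s v s≢0 → λ { ((i , v_i≢0) , a , a≢0 , Uav) →
        (i , *-≢0 s≢0 v_i≢0) , a * inv s s≢0 , *-≢0 a≢0 (inv-≢0 s s≢0) ,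
        U-resp (λ j → sym (trans (*-assoc a _ _) (cong (a *_) (inv-cancel s s≢0 (v j))))) Uav })

  𝓑-⊆ : ∀ {U B} → LinearK.IsPointSet B → (∀ v → U v → B v) → ∀ v → 𝓑 U v → B v
  𝓑-⊆ (B-resp , _ , B-scale) U⊆B v (_ , a , a≢0 , Uav) =
    B-resp _ _ (λ j → inv-cancel a a≢0 (v j)) (B-scale (inv a a≢0) (a ·K v) (inv-≢0 a a≢0) (U⊆B _ Uav))

  dot : V → V → Carrier K
  dot a x = sum (λ i → a i * x i)

  dot-cong : ∀ a {x y} → x ≐ y → dot a x ≡ dot a y
  dot-cong a x≐y = sum-cong-≗ (λ i → cong (a i *_) (x≐y i))

  dot-+V : ∀ a x y → dot a (x +V y) ≡ dot a x + dot a y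
  dot-+V a x y = trans (sum-cong-≗ {n} (λ i → distribˡ (a i) (x i) (y i)))
                       (∑-distrib-+ (λ i → a i * x i) (λ i → a i * y i))

  dot-scale : ∀ a s x → dot a (s ·K x) ≡ s * dot a x
  dot-scale a s x = trans (sum-cong-≗ {n} (λ i → swap (a i) (x i))) (sym (*-distribˡ-sum s (λ i → a i * x i)))
    where
    swap : ∀ y z → y * (s * z) ≡ s * (y * z)
    swap y z = trans (sym (*-assoc y s z)) (trans (cong (_* z) (*-comm y s)) (*-assoc s y z))

  dot-zeroV : ∀ a → dot a zeroV ≡ 0#
  dot-zeroV a = sum-zero _ (λ i → zeroʳ (a i))

  dot-sub : ∀ a a' x → dot a x + - dot a' x ≡ dot (λ i → a i + - a' i) x
  dot-sub a a' x = trans (sum-sub (λ i → a i * x i) (λ i → a' i * x i))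
                         (sum-cong-≗ {n} (λ i → sym ([y-z]x≈yx-zx (x i) (a i) (a' i))))

  dot-lincomb-0 : ∀ b {k} (c : Fin k → Carrier K) (w : Fin k → V) → (∀ j → dot b (w j) ≡ 0#) →
                  dot b (LinearK.lincomb c w) ≡ 0#
  dot-lincomb-0 b = LinearK.lincomb-closed (λ v → dot b v ≡ 0#)
    (dot-zeroV b)
    (λ u v u≡0 v≡0 → trans (dot-+V b u v) (trans (cong₂ _+_ u≡0 v≡0) (+-identityʳ 0#)))
    (λ s v v≡0 → trans (dot-scale b s v) (trans (cong (s *_) v≡0) (zeroʳ s)))

  unit : Fin n → Carrier K → V
  unit k x i with i FinP.≟ k
  ... | yes _ = x
  ... | no  _ = 0#

  unit-on : ∀ k x → unit k x k ≡ x
  unit-on k x with k FinP.≟ k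
  ... | yes _ = refl
  ... | no k≢k = ⊥-elim (k≢k refl)

  unit-off : ∀ k x i → i ≢ k → unit k x i ≡ 0#
  unit-off k x i i≢k with i FinP.≟ k
  ... | yes i≡k = ⊥-elim (i≢k i≡k)
  ... | no  _ = refl

  dot-unit : ∀ a k x → dot a (unit k x) ≡ a k * x
  dot-unit a k x =
    trans (sum-single _ k (λ i i≢k → trans (cong (a i *_) (unit-off k x i i≢k)) (zeroʳ (a i))))
          (cong (a k *_) (unit-on k x))

-- The kernel of a nonzero linear form x ↦ ⟨b , x⟩ on K^(n'+1) contains n'
-- independent vectors: if b_k ≠ 0, take e_j - (b_j / b_k) e_k for j ≠ k.
module Hyperplane (K : Field) (n' : ℕ) (b : Geometry.V K (suc n')) (k : Fin (suc n'))
                  (b_k≢0 : b k ≢ Field.0# K) where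
  open Vectors K (suc n')
  open Field K hiding (Carrier)
  open FieldFacts K
  open LinearK using (lincomb; lincomb-coord; Independent)

  ratio : Fin n' → Carrier K
  ratio j = - (b (punchIn k j) * inv (b k) b_k≢0)

  kernelBasis : Fin n' → V
  kernelBasis j = unit (punchIn k j) 1# +V (ratio j ·K unit k 1#)

  kernelBasis-off-k : ∀ j' j → kernelBasis j' (punchIn k j) ≡ unit (punchIn k j') 1# (punchIn k j)
  kernelBasis-off-k j' j =
    trans (cong (unit (punchIn k j') 1# (punchIn k j) +_)
                (trans (cong (ratio j' *_) (unit-off k 1# (punchIn k j) (FinP.punchInᵢ≢i k j))) (zeroʳ _)))
          (+-identityʳ _)

  -- Coordinate punchIn k j of a combination recovers the j-th coefficient.
  kernelBasis-independent : Independent kernelBasis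
  kernelBasis-independent γ γ≐0 j = begin
    γ j                                              ≡⟨ sym (*-identityʳ (γ j)) ⟩
    γ j * 1#                                         ≡⟨ cong (γ j *_) (sym (trans (kernelBasis-off-k j j)
                                                                                 (unit-on (punchIn k j) 1#))) ⟩
    γ j * kernelBasis j (punchIn k j)                ≡⟨ sym (sum-single _ j off) ⟩
    sum (λ j' → γ j' * kernelBasis j' (punchIn k j)) ≡⟨ sym (lincomb-coord γ kernelBasis (punchIn k j)) ⟩
    lincomb γ kernelBasis (punchIn k j)              ≡⟨ γ≐0 (punchIn k j) ⟩
    0#                                               ∎
    where
    open ≡-Reasoning
    off : ∀ j' → j' ≢ j → γ j' * kernelBasis j' (punchIn k j) ≡ 0#
    off j' j'≢j =
      trans (cong (γ j' *_) (trans (kernelBasis-off-k j' j)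
                                   (unit-off (punchIn k j') 1# (punchIn k j) (j'≢j ∘ sym ∘ FinP.punchIn-injective k j j'))))
            (zeroʳ _)

  kernelBasis-annihilated : ∀ j → dot b (kernelBasis j) ≡ 0#
  kernelBasis-annihilated j = begin
    dot b (kernelBasis j)
      ≡⟨ dot-+V b (unit (punchIn k j) 1#) (ratio j ·K unit k 1#) ⟩
    dot b (unit (punchIn k j) 1#) + dot b (ratio j ·K unit k 1#)
      ≡⟨ cong₂ _+_ (dot-unit b (punchIn k j) 1#) (dot-scale b (ratio j) (unit k 1#)) ⟩
    b (punchIn k j) * 1# + ratio j * dot b (unit k 1#)
      ≡⟨ cong₂ (λ x y → x + ratio j * y) (*-identityʳ _) (trans (dot-unit b k 1#) (*-identityʳ _)) ⟩
    b (punchIn k j) + ratio j * b k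
      ≡⟨ cong (b (punchIn k j) +_) ratio-b_k ⟩
    b (punchIn k j) + - b (punchIn k j)
      ≡⟨ -‿inverseʳ _ ⟩
    0#
      ∎
    where
    open ≡-Reasoning
    ratio-b_k : ratio j * b k ≡ - b (punchIn k j)
    ratio-b_k = trans (sym (-‿distribˡ-* _ (b k)))
                      (cong -_ (trans (*-assoc _ _ (b k))
                                      (trans (cong (b (punchIn k j) *_) (inv-l (b k) b_k≢0)) (*-identityʳ _))))

module FiniteVectors (K : Field) (n : ℕ) {NK : ℕ} (K↔ : Carrier K ↔ Fin NK) where
  open Vectors K n
  open Field K using (_*_; 0#)

  finiteK : Finite
  finiteK = finite-↔ K↔

  finiteV : Finite
  finiteV = finite-^ n finiteK

  _≟K_ : (x y : Carrier K) → Dec (x ≡ y)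
  _≟K_ = Finite._≈?_ finiteK

  _≐?_ : ∀ u v → Dec (u ≐ v)
  u ≐? v = FinP.all? (λ i → u i ≟K v i)

  𝓑? : ∀ {U} → (∀ v → Dec (U v)) → ∀ v → Dec (𝓑 U v)
  𝓑? U? v = FinP.any? (λ i → ¬? (v i ≟K 0#)) ×-dec
            Finite.any? finiteK (λ a → ¬? (a ≟K 0#) ×-dec U? (a ·K v)) (λ { refl h → h })

  module DecidableLinear {S : Set} {NS : ℕ} (S↔ : S ↔ Fin NS) (0s : S) (σ : S → Carrier K)
                         (_·_ : S → V → V) (·-def : ∀ s v i → (s · v) i ≡ σ s * v i) where
    open Linear 0s σ _·_ ·-def

    finiteS : Finite
    finiteS = finite-↔ S↔

    independent? : ∀ {k} (w : Fin k → V) → Dec (Independent w)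
    independent? {k} w =
      Finite.all? (finite-^ k finiteS)
        (λ c → lincomb c w ≐? zeroV →-dec FinP.all? (λ i → Finite._≈?_ finiteS (c i) 0s))
        (λ c≡c' h c'w≐0 i →
           trans (sym (c≡c' i)) (h (≐-trans (lincomb-cong c≡c' (λ _ → ≐-refl)) c'w≐0) i))

    inSpan? : ∀ {k} (w : Fin k → V) v → Dec (InSpan w v)
    inSpan? {k} w v =
      Finite.any? (finite-^ k finiteS) (λ c → v ≐? lincomb c w)
        (λ c≡c' v≐cw → ≐-trans v≐cw (lincomb-cong c≡c' (λ _ → ≐-refl)))

    blocking? : ∀ k (P : V → Set) → (∀ v → Dec (P v)) → (∀ {u v} → u ≐ v → P u → P v) →
                Dec (Blocking k P)
    blocking? k P P? P-resp =
      Finite.all? (finite-^ k finiteV)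
        (λ w → independent? w →-dec Finite.any? finiteV (λ v → P? v ×-dec inSpan? w v)
                                       (λ u≐v (Pu , u∈w) → P-resp u≐v Pu , inSpan-resp w u≐v u∈w))
        (λ w≐w' h ind' → let (v , Pv , v∈w) = h (independent-cong (≐-sym ∘ w≐w') ind')
                         in v , Pv , inSpan-cong w≐w' v∈w)

module SubfieldSpan {F K : Field} (e : Embedding F K) where
  open Embedding e
  open EmbeddingFacts e
  open Field K hiding (Carrier)
  open FieldFacts K
  private
    module F = Field F
    module FF = FieldFacts F

  flin : ∀ {d} → (Fin d → Carrier F) → (Fin d → Carrier K) → Carrier K
  flin c b = sum (λ j → ι (c j) * b j)

  FIndependent : ∀ {d} → (Fin d → Carrier K) → Set
  FIndependent b = ∀ c → flin c b ≡ 0# → ∀ j → c j ≡ F.0#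

  FSpan : ∀ {d} → (Fin d → Carrier K) → Carrier K → Set
  FSpan b x = ∃ λ c → x ≡ flin c b

  FSpanning : ∀ {d} → (Fin d → Carrier K) → Set
  FSpanning b = ∀ x → FSpan b x

  flin-cong : ∀ {d} {c c' : Fin d → Carrier F} b → (∀ j → c j ≡ c' j) → flin c b ≡ flin c' b
  flin-cong b c≡c' = sum-cong-≗ (λ j → cong (λ z → ι z * b j) (c≡c' j))

  flin-+ : ∀ {d} (c c' : Fin d → Carrier F) b → flin (λ j → c j F.+ c' j) b ≡ flin c b + flin c' b
  flin-+ c c' b = trans (sum-cong-≗ (λ j → trans (cong (_* b j) (ι-+ (c j) (c' j)))
                                                  (distribʳ (b j) _ _)))
                        (∑-distrib-+ (λ j → ι (c j) * b j) (λ j → ι (c' j) * b j))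

  flin-0 : ∀ {d} (c : Fin d → Carrier F) b → (∀ j → c j ≡ F.0#) → flin c b ≡ 0#
  flin-0 c b c≡0 = sum-zero _ (λ j → trans (cong (λ z → ι z * b j) (c≡0 j))
                                            (trans (cong (_* b j) ι-0) (zeroˡ (b j))))

  flin-scale : ∀ {d} s (c : Fin d → Carrier F) b → flin (λ j → s F.* c j) b ≡ ι s * flin c b
  flin-scale s c b = trans (sum-cong-≗ (λ j → trans (cong (_* b j) (ι-* s (c j))) (*-assoc _ _ _)))
                           (sym (*-distribˡ-sum (ι s) (λ j → ι (c j) * b j)))

  flin-neg : ∀ {d} (c : Fin d → Carrier F) b → flin (λ j → F.- c j) b ≡ - flin c b
  flin-neg c b = neg-unique (trans (sym (flin-+ c (λ j → F.- c j) b)) (flin-0 _ b (FF.-‿inverseʳ ∘ c)))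

  flin-injective : ∀ {d} (b : Fin d → Carrier K) → FIndependent b →
                   ∀ c c' → flin c b ≡ flin c' b → ∀ j → c j ≡ c' j
  flin-injective b ind c c' eq j = FF.sub≡0⇒≡ (ind (λ j → c j F.+ F.- c' j) c-c'≡0 j)
    where
    c-c'≡0 : flin (λ j → c j F.+ F.- c' j) b ≡ 0#
    c-c'≡0 = trans (flin-+ c _ b) (trans (cong (flin c b +_) (flin-neg c' b)) (≡⇒sub≡0 eq))

  cons : ∀ {A : Set} {d} → A → (Fin d → A) → Fin (suc d) → A
  cons x b zero    = x
  cons x b (suc j) = b j

  -- Adjoining an element outside the span keeps a family independent:
  -- a relation c₀ x + L = 0 with c₀ ≠ 0 would give x = flin (- c₀⁻¹ c_j) b.
  FIndependent-cons : (∀ (a b : Carrier F) → Dec (a ≡ b)) →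
                      ∀ {d} (b : Fin d → Carrier K) x → FIndependent b → ¬ FSpan b x →
                      FIndependent (cons x b)
  FIndependent-cons _≟F_ b x ind x∉b c rel with c zero ≟F F.0#
  ... | yes c₀≡0 = λ { zero → c₀≡0 ; (suc j) → ind (c ∘ suc) tail≡0 j }
    where
    tail≡0 : flin (c ∘ suc) b ≡ 0#
    tail≡0 = trans (sym (+-identityˡ _))
                   (trans (cong (_+ flin (c ∘ suc) b) (sym (trans (cong (λ z → ι z * x) c₀≡0)
                                                                  (trans (cong (_* x) ι-0) (zeroˡ x)))))
                          rel)
  ... | no c₀≢0 = ⊥-elim (x∉b ((λ j → F.- (a F.* c (suc j))) , x≡))
    where
    a = FF.inv (c zero) c₀≢0
    L = flin (c ∘ suc) b
    c₀x≡-L : ι (c zero) * x ≡ - L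
    c₀x≡-L = neg-unique (trans (+-comm L _) rel)
    x≡ : x ≡ flin (λ j → F.- (a F.* c (suc j))) b
    x≡ = begin
      x                                    ≡⟨ sym (*-identityˡ x) ⟩
      1# * x                               ≡⟨ cong (_* x) (trans (sym ι-1) (trans (cong ι (sym (FF.inv-l _ c₀≢0)))
                                                                               (ι-* a _))) ⟩
      (ι a * ι (c zero)) * x               ≡⟨ *-assoc _ _ x ⟩
      ι a * (ι (c zero) * x)               ≡⟨ cong (ι a *_) c₀x≡-L ⟩
      ι a * - L                            ≡⟨ sym (-‿distribʳ-* (ι a) L) ⟩
      - (ι a * L)                          ≡⟨ cong -_ (sym (flin-scale a (c ∘ suc) b)) ⟩
      - flin (λ j → a F.* c (suc j)) b     ≡⟨ sym (flin-neg _ b) ⟩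
      flin (λ j → F.- (a F.* c (suc j))) b ∎
      where open ≡-Reasoning

-- If |F| = q > 1 and |K| = q^t, then K has an F-basis of exactly t
-- elements: coefficient maps F^d → K of independent families are
-- injective (so d ≤ t), those of spanning families surjective (so t ≤ d),
-- and an independent family can be extended until it spans.
module SubfieldBasis (q t : ℕ) (1<q : 1 < q) {F K : Field}
                     (F↔ : Carrier F ↔ Fin q) (K↔ : Carrier K ↔ Fin (q ℕ.^ t)) (e : Embedding F K) where
  open SubfieldSpan e

  finiteF : Finite
  finiteF = finite-↔ F↔

  finiteK : Finite
  finiteK = finite-↔ K↔

  independent-size : ∀ {d} (b : Fin d → Carrier K) → FIndependent b → ¬ t < d
  independent-size {d} b ind t<d
    with pigeonhole (finite-^ d finiteF) finiteK (ℕP.^-monoʳ-< q 1<q t<d) (λ c → flin c b)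
  ... | c , c' , c≉c' , eq = c≉c' (flin-injective b ind c c' eq)

  spanning-size : ∀ {d} (b : Fin d → Carrier K) → FSpanning b → ¬ d < t
  spanning-size {d} b span d<t
    with pigeonhole finiteK (finite-^ d finiteF) (ℕP.^-monoʳ-< q 1<q d<t) (proj₁ ∘ span)
  ... | x , x' , x≢x' , eq = x≢x' (trans (proj₂ (span x)) (trans (flin-cong b eq) (sym (proj₂ (span x')))))

  FSpan? : ∀ {d} (b : Fin d → Carrier K) x → Dec (FSpan b x)
  FSpan? {d} b x = Finite.any? (finite-^ d finiteF) (λ c → Finite._≈?_ finiteK x (flin c b))
                     (λ c≡c' x≡cb → trans x≡cb (flin-cong b c≡c'))

  -- Extend an independent family by elements outside its span until it
  -- spans; `fuel` bounds the number of steps, as d never exceeds t.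
  extend : ∀ fuel {d} → d ℕ.+ fuel ≡ t → (b : Fin d → Carrier K) → FIndependent b →
           ∃₂ λ d' (b' : Fin d' → Carrier K) → FIndependent b' × FSpanning b'
  extend fuel {d} d+fuel≡t b ind with Finite.any? finiteK (λ x → ¬? (FSpan? b x)) (λ { refl x∉b → x∉b })
  ... | no ¬∃x∉b = d , b , ind , λ x → decidable-stable (FSpan? b x) (λ x∉b → ¬∃x∉b (x , x∉b))
  ... | yes (x , x∉b) with fuel | FIndependent-cons (Finite._≈?_ finiteF) b x ind x∉b
  ...   | zero      | ind' = ⊥-elim (independent-size (cons x b) ind' (s≤s (ℕP.≤-reflexive t≡d)))
    where t≡d = trans (sym d+fuel≡t) (ℕP.+-identityʳ d)
  ...   | suc fuel' | ind' = extend fuel' (trans (sym (ℕP.+-suc d fuel')) d+fuel≡t) (cons x b) ind'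

  basis : Σ (Fin t → Carrier K) λ b → FIndependent b × FSpanning b
  basis with extend t refl (λ ()) (λ c _ ())
  ... | d , b , ind , span with ℕP.<-cmp d t
  ...   | tri< d<t _ _    = ⊥-elim (spanning-size b span d<t)
  ...   | tri≈ _ refl _   = b , ind , span
  ...   | tri> _ _ t<d    = ⊥-elim (independent-size b ind t<d)

module FirstCoordinate {F K : Field} (e : Embedding F K) {d : ℕ} (b : Fin (suc d) → Carrier K)
                       (ind : SubfieldSpan.FIndependent e b) (span : SubfieldSpan.FSpanning e b) where
  open SubfieldSpan e
  open Embedding e
  open Field K hiding (Carrier)
  open FieldFacts K using (+-identityʳ; *-identityˡ)
  private module F = Field F

  coords : Carrier K → Fin (suc d) → Carrier F
  coords x = proj₁ (span x)

  coords-unique : ∀ x c → x ≡ flin c b → ∀ j → coords x j ≡ c j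
  coords-unique x c x≡cb = flin-injective b ind (coords x) c (trans (sym (proj₂ (span x))) x≡cb)

  φ : Carrier K → Carrier F
  φ x = coords x zero

  φ-+ : ∀ x y → φ (x + y) ≡ φ x F.+ φ y
  φ-+ x y = coords-unique (x + y) (λ j → coords x j F.+ coords y j)
              (trans (cong₂ _+_ (proj₂ (span x)) (proj₂ (span y))) (sym (flin-+ (coords x) (coords y) b))) zero

  φ-sub : ∀ x y → φ (x + - y) ≡ φ x F.+ F.- φ y
  φ-sub x y = coords-unique (x + - y) (λ j → coords x j F.+ F.- coords y j)
                (trans (cong₂ (λ u v → u + - v) (proj₂ (span x)) (proj₂ (span y)))
                       (sym (trans (flin-+ (coords x) (λ j → F.- coords y j) b)
                                   (cong (flin (coords x) b +_) (flin-neg (coords y) b))))) zero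

  φ-scale : ∀ s x → φ (ι s * x) ≡ s F.* φ x
  φ-scale s x = coords-unique (ι s * x) (λ j → s F.* coords x j)
                  (trans (cong (ι s *_) (proj₂ (span x))) (sym (flin-scale s (coords x) b))) zero

  φ-0 : φ 0# ≡ F.0#
  φ-0 = coords-unique 0# (λ _ → F.0#) (sym (flin-0 (λ _ → F.0#) b (λ _ → refl))) zero

  φ-b₀ : φ (b zero) ≡ F.1#
  φ-b₀ = coords-unique (b zero) (cons F.1# (λ _ → F.0#))
           (sym (trans (cong₂ _+_ (trans (cong (_* b zero) ι-1) (*-identityˡ (b zero)))
                                  (flin-0 (λ _ → F.0#) (b ∘ suc) (λ _ → refl)))
                       (+-identityʳ (b zero)))) zero

module FieldReduction {F K : Field} (e : Embedding F K) (n : ℕ) {t : ℕ}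
                      (b : Fin t → Carrier K) (b-ind : SubfieldSpan.FIndependent e b) where
  open Vectors K n
  open SubfieldSpan e
  open Embedding e
  open Field K hiding (Carrier)
  open FieldFacts K using (sum; sum-cong-≗; *-assoc; *-distribʳ-sum; *-identityˡ; 1≢0)
  private
    module F = Field F
    module LF = LinearF e
    module LK = LinearK

  expand : ∀ r → (Fin r → V) → Fin (r ℕ.* t) → V
  expand zero    h ()
  expand (suc r) h idx = [ (λ j → b j ·K h zero) , expand r (h ∘ suc) ]′ (splitAt t idx)

  -- The K-coefficient of h_i in the combination with F-coefficients c.
  collect : ∀ r → (Fin (r ℕ.* t) → Carrier F) → Fin r → Carrier K
  collect (suc r) c zero    = flin (c ∘ (_↑ˡ (r ℕ.* t))) b
  collect (suc r) c (suc i) = collect r (c ∘ (t ↑ʳ_)) i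

  expand-↑ˡ : ∀ r h j → expand (suc r) h (j ↑ˡ (r ℕ.* t)) ≡ b j ·K h zero
  expand-↑ˡ r h j rewrite FinP.splitAt-↑ˡ t j (r ℕ.* t) = refl

  expand-↑ʳ : ∀ r h j → expand (suc r) h (t ↑ʳ j) ≡ expand r (h ∘ suc) j
  expand-↑ʳ r h j rewrite FinP.splitAt-↑ʳ t (r ℕ.* t) j = refl

  lincomb-multiples : ∀ (c : Fin t → Carrier F) x → LF.lincomb c (λ j → b j ·K x) ≐ (flin c b ·K x)
  lincomb-multiples c x i = begin
    LF.lincomb c (λ j → b j ·K x) i     ≡⟨ LF.lincomb-coord c _ i ⟩
    sum (λ j → ι (c j) * (b j * x i))   ≡⟨ sum-cong-≗ (λ j → sym (*-assoc (ι (c j)) (b j) (x i))) ⟩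
    sum (λ j → (ι (c j) * b j) * x i)   ≡⟨ sym (*-distribʳ-sum (x i) (λ j → ι (c j) * b j)) ⟩
    flin c b * x i                      ∎
    where open ≡-Reasoning

  expand-lincomb : ∀ r h (c : Fin (r ℕ.* t) → Carrier F) →
                   LF.lincomb c (expand r h) ≐ LK.lincomb (collect r c) h
  expand-lincomb zero    h c i = refl
  expand-lincomb (suc r) h c i =
    trans (LF.lincomb-++ t c (expand (suc r) h) i)
          (cong₂ _+_ (trans (LF.lincomb-cong (λ _ → refl) (λ j i' → cong (λ v → v i') (expand-↑ˡ r h j)) i)
                            (lincomb-multiples (c ∘ (_↑ˡ (r ℕ.* t))) (h zero) i))
                     (trans (LF.lincomb-cong (λ _ → refl) (λ j i' → cong (λ v → v i') (expand-↑ʳ r h j)) i)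
                            (expand-lincomb r (h ∘ suc) (c ∘ (t ↑ʳ_)) i)))

  join-split : ∀ {r} (idx : Fin (t ℕ.+ r)) {s} → splitAt t idx ≡ s → idx ≡ join t r s
  join-split {r} idx refl = sym (FinP.join-splitAt t r idx)

  collect-zero : ∀ r (c : Fin (r ℕ.* t) → Carrier F) → (∀ i → collect r c i ≡ 0#) → ∀ idx → c idx ≡ F.0#
  collect-zero (suc r) c c≡0 idx with splitAt t idx in eq
  ... | inj₁ j = subst (λ z → c z ≡ F.0#) (sym (join-split idx eq))
                       (b-ind (c ∘ (_↑ˡ (r ℕ.* t))) (c≡0 zero) j)
  ... | inj₂ j = subst (λ z → c z ≡ F.0#) (sym (join-split idx eq))
                       (collect-zero r (c ∘ (t ↑ʳ_)) (c≡0 ∘ suc) j)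

  expand-independent : ∀ r h → LK.Independent h → LF.Independent (expand r h)
  expand-independent r h h-ind c c·e≐0 =
    collect-zero r c (h-ind (collect r c) (≐-trans (≐-sym (expand-lincomb r h c)) c·e≐0))

  expand-span : ∀ r h {v} → LF.InSpan (expand r h) v → LK.InSpan h v
  expand-span r h (c , v≐) = collect r c , ≐-trans v≐ (expand-lincomb r h c)

  𝓑-blocks : ∀ r {U} → LF.IsPointSet U → LF.Blocking (r ℕ.* t) U → LK.Blocking r (𝓑 U)
  𝓑-blocks r (U-resp , U-nonzero , _) U-blocks h h-ind =
    let (v , Uv , v∈) = U-blocks (expand r h) (expand-independent r h h-ind)
    in v , (U-nonzero v Uv , 1# , 1≢0 , U-resp _ _ (λ j → sym (*-identityˡ (v j))) Uv) , expand-span r h v∈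

-- Let |F| = q, |K| = q^t, V = K^n and let P be a K-point set meeting every
-- K-hyperplane.  Then P meets every F-subspace W of F-dimension m whenever
-- t(n-1) ≤ m < tn.  Indeed, as m < tn some nonzero linear form ⟨b , -⟩
-- has φ ⟨b , W⟩ = 0 (φ the first F-coordinate on K); P contains a point x
-- of the K-hyperplane ker ⟨b , -⟩; and K x and W both lie in the F-hyperplane
-- {v : φ ⟨b , v⟩ = 0}, so for t + m ≥ tn they meet in a nonzero vector.
module HyperplanesBlockSubspaces (q t' n' : ℕ) (1<q : 1 < q) {F K : Field}
                                 (F↔ : Carrier F ↔ Fin q) (K↔ : Carrier K ↔ Fin (q ℕ.^ suc t'))
                                 (e : Embedding F K) where
  t n : ℕ
  t = suc t'
  n = suc n'

  open Vectors K n
  open FiniteVectors K n K↔ using (finiteK; finiteV; _≟K_)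
  open SubfieldBasis q t 1<q F↔ K↔ e using (finiteF; basis)
  open FirstCoordinate e (proj₁ basis) (proj₁ (proj₂ basis)) (proj₂ (proj₂ basis))
  open Embedding e
  open EmbeddingFacts e using (ι-0)
  open Field K hiding (Carrier)
  open FieldFacts K
  private
    module F = Field F
    module FF = FieldFacts F
    module LF = LinearF e
    module LK = LinearK

  μ : Carrier K
  μ = proj₁ basis zero

  φ-kernel : V → V → Set
  φ-kernel b v = φ (dot b v) ≡ F.0#

  φ-kernel-lincomb : ∀ b {k} (c : Fin k → Carrier F) (w : Fin k → V) → (∀ j → φ-kernel b (w j)) →
                     φ-kernel b (LF.lincomb c w)
  φ-kernel-lincomb b = LF.lincomb-closed (φ-kernel b)
    (trans (cong φ (dot-zeroV b)) φ-0)
    (λ u v φu≡0 φv≡0 → trans (cong φ (dot-+V b u v))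
                             (trans (φ-+ _ _) (trans (cong₂ F._+_ φu≡0 φv≡0) (FF.+-identityʳ F.0#))))
    (λ s v φv≡0 → trans (cong φ (dot-scale b (ι s) v))
                        (trans (φ-scale s _) (trans (cong (s F.*_) φv≡0) (FF.zeroʳ s))))

  q≢0 : ℕ.NonZero q
  q≢0 = ℕ.>-nonZero (ℕP.<-trans (s≤s z≤n) 1<q)

  size-V : size finiteV ≡ q ℕ.^ (t ℕ.* n)
  size-V = ℕP.^-*-assoc q t n

  |V|≤|K×Fᵐ| : ∀ {m} → t ℕ.* n ≤ t ℕ.+ m →
               size finiteV ≤ size (finite-× finiteK (finite-^ m finiteF))
  |V|≤|K×Fᵐ| {m} tn≤t+m = begin
    size finiteV            ≡⟨ size-V ⟩
    q ℕ.^ (t ℕ.* n)         ≤⟨ ℕP.^-monoʳ-≤ q {{q≢0}} tn≤t+m ⟩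
    q ℕ.^ (t ℕ.+ m)         ≡⟨ ℕP.^-distribˡ-+-* q t m ⟩
    q ℕ.^ t ℕ.* q ℕ.^ m     ∎
    where open ℕP.≤-Reasoning

  -- A nonzero linear form whose φ-kernel contains m < tn given vectors:
  -- a ↦ (φ ⟨a , w_j⟩)_j maps q^(tn) vectors to q^m values, and the
  -- difference of a colliding pair is the form sought.
  annihilator : ∀ {m} → m < t ℕ.* n → (w : Fin m → V) →
                ∃₂ λ b k → b k ≢ 0# × (∀ j → φ-kernel b (w j))
  annihilator {m} m<tn w
    with pigeonhole finiteV (finite-^ m finiteF)
                    (subst (q ℕ.^ m <_) (sym size-V) (ℕP.^-monoʳ-< q 1<q m<tn))
                    (λ a j → φ (dot a (w j)))
  ... | a , a' , a≉a' , eq with FinP.¬∀⟶∃¬ n (λ i → a i ≡ a' i) (λ i → a i ≟K a' i) a≉a'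
  ... | k , a_k≢a'_k = (λ i → a i + - a' i) , k , a_k≢a'_k ∘ sub≡0⇒≡ ,
                       λ j → trans (cong φ (sym (dot-sub a a' (w j))))
                                   (trans (φ-sub (dot a (w j)) (dot a' (w j))) (FF.≡⇒sub≡0 (eq j)))

  module _ {m : ℕ} (w : Fin m → V) (w-ind : LF.Independent w) (x : V) where
    spanMap : Carrier K × (Fin m → Carrier F) → V
    spanMap (l , c) = (l ·K x) +V LF.lincomb c w

    MultipleInSpan : Set
    MultipleInSpan = ∃ λ Λ → Λ ≢ 0# × LF.InSpan w (Λ ·K x)

    different-preimages : ∀ l c l' c' → ¬ (l ≡ l' × (∀ j → c j ≡ c' j)) →
                         spanMap (l , c) ≐ spanMap (l' , c') → MultipleInSpan
    different-preimages l c l' c' differ eq with l ≟K l'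
    ... | yes refl = ⊥-elim (differ (refl , λ j → FF.sub≡0⇒≡ (w-ind (λ j → c j F.+ F.- c' j) c-c'≐0 j)))
      where
      c-c'≐0 : LF.lincomb (λ j → c j F.+ F.- c' j) w ≐ zeroV
      c-c'≐0 i = trans (sym (LF.lincomb-sub c c' w i))
                       (≡⇒sub≡0 (∙-cancelˡ (l * x i) (LF.lincomb c w i) (LF.lincomb c' w i) (eq i)))
    ... | no l≢l' = l + - l' , l≢l' ∘ sub≡0⇒≡ , (λ j → c' j F.+ F.- c j) , Λx≐
      where
      Λx≐ : ((l + - l') ·K x) ≐ LF.lincomb (λ j → c' j F.+ F.- c j) w
      Λx≐ i = begin
        (l + - l') * x i                         ≡⟨ [y-z]x≈yx-zx (x i) l l' ⟩
        l * x i + - (l' * x i)                   ≡⟨ transpose {l * x i} {LF.lincomb c w i} (eq i) ⟩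
        LF.lincomb c' w i + - LF.lincomb c w i   ≡⟨ LF.lincomb-sub c' c w i ⟩
        LF.lincomb (λ j → c' j F.+ F.- c j) w i  ∎
        where open ≡-Reasoning

    collision⇒multiple : Collision (finite-× finiteK (finite-^ m finiteF)) finiteV spanMap → MultipleInSpan
    collision⇒multiple ((l , c) , (l' , c') , differ , eq) = different-preimages l c l' c' differ eq

    -- If x and all w_j lie in the φ-kernel of a nonzero form, the image of
    -- spanMap lies there too and misses the vector u with ⟨b , u⟩ = μ.
    module _ (b : V) (k : Fin n) (b_k≢0 : b k ≢ 0#) (w⊆ker : ∀ j → φ-kernel b (w j))
             (x∈ker : dot b x ≡ 0#) where
      u : V
      u = unit k (inv (b k) b_k≢0 * μ)

      ⟨b,u⟩≡μ : dot b u ≡ μ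
      ⟨b,u⟩≡μ = trans (dot-unit b k _)
                      (trans (sym (*-assoc (b k) _ μ)) (trans (cong (_* μ) (inv-r (b k) b_k≢0)) (*-identityˡ μ)))

      image⊆ker : ∀ l c → φ-kernel b (spanMap (l , c))
      image⊆ker l c = begin
        φ (dot b ((l ·K x) +V LF.lincomb c w))          ≡⟨ cong φ (dot-+V b (l ·K x) (LF.lincomb c w)) ⟩
        φ (dot b (l ·K x) + dot b (LF.lincomb c w))     ≡⟨ cong (λ z → φ (z + dot b (LF.lincomb c w))) ⟨b,lx⟩≡0 ⟩
        φ (0# + dot b (LF.lincomb c w))                 ≡⟨ cong φ (+-identityˡ _) ⟩
        φ (dot b (LF.lincomb c w))                      ≡⟨ φ-kernel-lincomb b c w w⊆ker ⟩
        F.0#                                            ∎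
        where
        open ≡-Reasoning
        ⟨b,lx⟩≡0 : dot b (l ·K x) ≡ 0#
        ⟨b,lx⟩≡0 = trans (dot-scale b l x) (trans (cong (l *_) x∈ker) (zeroʳ l))

      misses-u : ∀ lc → ¬ spanMap lc ≐ u
      misses-u (l , c) eq =
        F.0≢1 (trans (sym (image⊆ker l c)) (trans (cong φ (trans (dot-cong b eq) ⟨b,u⟩≡μ)) φ-b₀))

      multiple-in-span : t ℕ.* n ≤ t ℕ.+ m → MultipleInSpan
      multiple-in-span tn≤t+m = collision⇒multiple
        (pigeonhole-missing (finite-× finiteK (finite-^ m finiteF)) finiteV (|V|≤|K×Fᵐ| tn≤t+m) spanMap u misses-u)

  hyperplanes⇒subspaces : ∀ m → m < t ℕ.* n → t ℕ.* n ≤ t ℕ.+ m →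
                          (P : V → Set) → LK.IsPointSet P → LK.Blocking n' P → LF.Blocking m P
  hyperplanes⇒subspaces m m<tn tn≤t+m P P-points P-blocks w w-ind =
    let (b , k , b_k≢0 , w⊆ker) = annihilator m<tn w
        open Hyperplane K n' b k b_k≢0
        (x , Px , γ , x≐) = P-blocks kernelBasis kernelBasis-independent
        x∈ker = trans (dot-cong b x≐) (dot-lincomb-0 b γ kernelBasis kernelBasis-annihilated)
        (Λ , Λ≢0 , Λx∈w) = multiple-in-span w w-ind x b k b_k≢0 w⊆ker x∈ker tn≤t+m
    in Λ ·K x , proj₂ (proj₂ P-points) Λ x Λ≢0 Px , Λx∈w

-- A K-point set B meeting every k-dimensional subspace contains a
-- decidable K-point set that still meets all of them: enumerate the
-- families of k vectors, choose for each independent one a point of B in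
-- its span, and take all nonzero multiples of the chosen points.
module DecidableCore (K : Field) (n : ℕ) {NK : ℕ} (K↔ : Carrier K ↔ Fin NK) (k : ℕ)
                     (B : Geometry.V K n → Set) (B-points : Geometry.OverK.IsPointSet K n B)
                     (B-blocks : Geometry.OverK.Blocking K n k B) where
  open Vectors K n
  open FiniteVectors K n K↔
  open Field K hiding (Carrier)
  open FieldFacts K using (*-identityˡ; *-assoc; 1≢0; *-≢0)
  open LinearK using (IsPointSet; Blocking; InSpan; independent-cong; inSpan-cong)
  open DecidableLinear K↔ 0# (λ a → a) _·K_ (λ _ _ _ → refl) using (independent?)

  families : Finite
  families = finite-^ k finiteV

  chosen : Fin (size families) → Maybe V
  chosen i with independent? (decode families i)
  ... | yes ind = just (proj₁ (B-blocks (decode families i) ind))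
  ... | no  _   = nothing

  chosen-spec : ∀ i x → chosen i ≡ just x → B x × InSpan (decode families i) x
  chosen-spec i x eq with independent? (decode families i)
  chosen-spec i x refl | yes ind = proj₂ (B-blocks (decode families i) ind)

  chosen-exists : ∀ i → LinearK.Independent (decode families i) → ∃ λ x → chosen i ≡ just x
  chosen-exists i ind with independent? (decode families i)
  ... | yes _  = _ , refl
  ... | no ¬ind = ⊥-elim (¬ind ind)

  MultipleOfChosen : Fin (size families) → V → Set
  MultipleOfChosen i v = ∃ λ x → chosen i ≡ just x × ∃ λ a → a ≢ 0# × v ≐ (a ·K x)

  Core : V → Set
  Core v = ∃ λ i → MultipleOfChosen i v

  multipleOfChosen? : ∀ i v → Dec (MultipleOfChosen i v)
  multipleOfChosen? i v with chosen i
  ... | nothing = no (λ { (_ , () , _) })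
  ... | just x with Finite.any? finiteK (λ a → ¬? (a ≟K 0#) ×-dec v ≐? (a ·K x)) (λ { refl h → h })
  ...   | yes (a , a≢0 , v≐ax) = yes (x , refl , a , a≢0 , v≐ax)
  ...   | no ¬a = no (λ { (_ , refl , a , a≢0 , v≐ax) → ¬a (a , a≢0 , v≐ax) })

  Core? : ∀ v → Dec (Core v)
  Core? v = FinP.any? (λ i → multipleOfChosen? i v)

  Core-resp : ∀ {u v} → u ≐ v → Core u → Core v
  Core-resp u≐v (i , x , eq , a , a≢0 , u≐ax) = i , x , eq , a , a≢0 , ≐-trans (≐-sym u≐v) u≐ax

  Core⊆B : ∀ v → Core v → B v
  Core⊆B v (i , x , eq , a , a≢0 , v≐ax) =
    proj₁ B-points _ _ (≐-sym v≐ax) (proj₂ (proj₂ B-points) a x a≢0 (proj₁ (chosen-spec i x eq)))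

  Core-points : IsPointSet Core
  Core-points = (λ u v → Core-resp) , (λ v → proj₁ (proj₂ B-points) v ∘ Core⊆B v) ,
    λ { s v s≢0 (i , x , eq , a , a≢0 , v≐ax) →
          i , x , eq , s * a , *-≢0 s≢0 a≢0 , λ j → trans (cong (s *_) (v≐ax j)) (sym (*-assoc s a (x j))) }

  Core-blocks : Blocking k Core
  Core-blocks w ind =
    let i = encode families w
        (x , eq) = chosen-exists i (independent-cong (≐-sym ∘ decode-encode families w) ind)
    in x , (i , x , eq , 1# , 1≢0 , λ j → sym (*-identityˡ (x j))) ,
       inSpan-cong (decode-encode families w) (proj₂ (chosen-spec i x eq))

-- Over finite fields F ⊆ K, every decidable F-point set S meeting all
-- m-dimensional F-subspaces contains a minimal such set: run through all
-- vectors x and delete the point ⟨x⟩_F whenever what remains still blocks.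
-- A point that survived its turn could not be deleted from a superset of
-- the final set, so it cannot be deleted from the final set either.
module MinimalSubset {F K : Field} (e : Embedding F K) (n : ℕ) {NF NK : ℕ}
                     (F↔ : Carrier F ↔ Fin NF) (K↔ : Carrier K ↔ Fin NK) (m : ℕ) where
  open Vectors K n
  open FiniteVectors K n K↔ using (finiteV; _≐?_)
  open Embedding e
  open Field K hiding (Carrier)
  open FieldFacts K using (*-identityˡ; *-assoc)
  open LinearF e
  open FiniteVectors.DecidableLinear K n K↔ F↔ (Field.0# F) ι (OverF._·F_ F e) (λ _ _ _ → refl) using (blocking?)
  private
    module F = Field F
    module FF = FieldFacts F
    finiteF = finite-↔ F↔

  _·F_ : Carrier F → V → V
  _·F_ = OverF._·F_ F e

  record DecidableSet : Set₁ where
    field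
      member      : V → Set
      member?     : ∀ v → Dec (member v)
      member-resp : ∀ {u v} → u ≐ v → member u → member v
  open DecidableSet public

  OnPoint : V → V → Set
  OnPoint x y = ∃ λ s → s ≢ F.0# × y ≐ (s ·F x)

  OnPoint? : ∀ x y → Dec (OnPoint x y)
  OnPoint? x y = Finite.any? finiteF (λ s → ¬? (Finite._≈?_ finiteF s F.0#) ×-dec y ≐? (s ·F x))
                              (λ { refl h → h })

  OnPoint-refl : ∀ x → OnPoint x x
  OnPoint-refl x = F.1# , FF.1≢0 , λ i → sym (trans (cong (_* x i) ι-1) (*-identityˡ (x i)))

  ·F-cancel : ∀ s (s≢0 : s ≢ F.0#) y → (FF.inv s s≢0 ·F (s ·F y)) ≐ y
  ·F-cancel s s≢0 y i = trans (sym (*-assoc _ (ι s) (y i)))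
    (trans (cong (_* y i) (trans (sym (ι-* _ s)) (trans (cong ι (FF.inv-l s s≢0)) ι-1))) (*-identityˡ (y i)))

  OnPoint-member : ∀ {P} → IsPointSet P → ∀ {x y} → OnPoint x y → P y → P x
  OnPoint-member (P-resp , _ , P-scale) {x} {y} (s , s≢0 , y≐sx) Py =
    P-resp _ _ (λ i → trans (cong (ι (FF.inv s s≢0) *_) (y≐sx i)) (·F-cancel s s≢0 x i))
               (P-scale (FF.inv s s≢0) y (FF.inv-≢0 s s≢0) Py)

  OnPoint-unscale : ∀ x y s (s≢0 : s ≢ F.0#) → OnPoint x (s ·F y) → OnPoint x y
  OnPoint-unscale x y s s≢0 (r , r≢0 , sy≐rx) =
    FF.inv s s≢0 F.* r , FF.*-≢0 (FF.inv-≢0 s s≢0) r≢0 ,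
    λ i → trans (sym (·F-cancel s s≢0 y i))
                (trans (cong (ι (FF.inv s s≢0) *_) (sy≐rx i))
                       (trans (sym (*-assoc _ _ (x i))) (cong (_* x i) (sym (ι-* (FF.inv s s≢0) r)))))

  withoutPoint : DecidableSet → V → DecidableSet
  withoutPoint S x = record
    { member      = λ y → member S y × ¬ OnPoint x y
    ; member?     = λ y → member? S y ×-dec ¬? (OnPoint? x y)
    ; member-resp = λ u≐v (Su , u∉x) →
        member-resp S u≐v Su , λ { (s , s≢0 , v≐sx) → u∉x (s , s≢0 , ≐-trans u≐v v≐sx) } }

  withoutPoint-points : ∀ S x → IsPointSet (member S) → IsPointSet (member (withoutPoint S x))
  withoutPoint-points S x (_ , S-nonzero , S-scale) =
    (λ u v → member-resp (withoutPoint S x)) , (λ v → S-nonzero v ∘ proj₁) ,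
    λ s v s≢0 (Sv , v∉x) → S-scale s v s≢0 Sv , v∉x ∘ OnPoint-unscale x v s s≢0

  Blocks : DecidableSet → Set
  Blocks S = Blocking m (member S)

  blocks? : ∀ S → Dec (Blocks S)
  blocks? S = blocking? m (member S) (member? S) (member-resp S)

  stepWith : (S : DecidableSet) (x : V) → Dec (member S x) → Dec (Blocks (withoutPoint S x)) → DecidableSet
  stepWith S x (yes _) (yes _) = withoutPoint S x
  stepWith S x _       _       = S

  step : DecidableSet → V → DecidableSet
  step S x = stepWith S x (member? S x) (blocks? (withoutPoint S x))

  stepWith-⊆ : ∀ S x d d' v → member (stepWith S x d d') v → member S v
  stepWith-⊆ S x (yes _) (yes _) v = proj₁
  stepWith-⊆ S x (yes _) (no _)  v = λ Sv → Sv
  stepWith-⊆ S x (no _)  _       v = λ Sv → Sv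

  stepWith-points : ∀ S x d d' → IsPointSet (member S) → IsPointSet (member (stepWith S x d d'))
  stepWith-points S x (yes _) (yes _) = withoutPoint-points S x
  stepWith-points S x (yes _) (no _)  = λ P → P
  stepWith-points S x (no _)  _       = λ P → P

  stepWith-blocks : ∀ S x d d' → Blocks S → Blocks (stepWith S x d d')
  stepWith-blocks S x (yes _) (yes blk) _ = blk
  stepWith-blocks S x (yes _) (no _)    b = b
  stepWith-blocks S x (no _)  _         b = b

  stepWith-survivor : ∀ S x d d' → member (stepWith S x d d') x → ¬ Blocks (withoutPoint S x)
  stepWith-survivor S x (yes _) (yes _)   (_ , x∉x) = ⊥-elim (x∉x (OnPoint-refl x))
  stepWith-survivor S x (yes _) (no ¬blk) _         = ¬blk
  stepWith-survivor S x (no ¬Sx) _        Sx        = ⊥-elim (¬Sx Sx)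

  step-⊆ : ∀ S x v → member (step S x) v → member S v
  step-⊆ S x = stepWith-⊆ S x (member? S x) (blocks? (withoutPoint S x))

  step-points : ∀ S x → IsPointSet (member S) → IsPointSet (member (step S x))
  step-points S x = stepWith-points S x (member? S x) (blocks? (withoutPoint S x))

  step-blocks : ∀ S x → Blocks S → Blocks (step S x)
  step-blocks S x = stepWith-blocks S x (member? S x) (blocks? (withoutPoint S x))

  step-survivor : ∀ S x → member (step S x) x → ¬ Blocks (withoutPoint S x)
  step-survivor S x = stepWith-survivor S x (member? S x) (blocks? (withoutPoint S x))

  prune : List V → DecidableSet → DecidableSet
  prune []       S = S
  prune (x ∷ xs) S = prune xs (step S x)

  prune-⊆ : ∀ xs S v → member (prune xs S) v → member S v
  prune-⊆ []       S v = λ Sv → Sv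
  prune-⊆ (x ∷ xs) S v = step-⊆ S x v ∘ prune-⊆ xs (step S x) v

  prune-points : ∀ xs S → IsPointSet (member S) → IsPointSet (member (prune xs S))
  prune-points []       S = λ P → P
  prune-points (x ∷ xs) S = prune-points xs (step S x) ∘ step-points S x

  prune-blocks : ∀ xs S → Blocks S → Blocks (prune xs S)
  prune-blocks []       S = λ b → b
  prune-blocks (x ∷ xs) S = prune-blocks xs (step S x) ∘ step-blocks S x

  prune-survivor : ∀ xs S x → x ∈ xs → member (prune xs S) x →
                   ∃ λ T → (∀ v → member (prune xs S) v → member T v) × ¬ Blocks (withoutPoint T x)
  prune-survivor (x ∷ xs) S x (here refl) Rx =
    S , (λ v → step-⊆ S x v ∘ prune-⊆ xs (step S x) v) , step-survivor S x (prune-⊆ xs (step S x) x Rx)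
  prune-survivor (y ∷ xs) S x (there x∈xs) Rx = prune-survivor xs (step S y) x x∈xs Rx

  allV : List V
  allV = Data.List.map (decode finiteV) (allFin (size finiteV))

  allV-complete : ∀ v → decode finiteV (encode finiteV v) ∈ allV
  allV-complete v = ∈-map⁺ (decode finiteV) (∈-allFin (encode finiteV v))

  minimal : (S : DecidableSet) → IsPointSet (member S) → Blocks S → MinimalBlocking m (member (prune allV S))
  minimal S S-points S-blocks = prune-points allV S S-points , prune-blocks allV S S-blocks , no-proper-blocking
    where
    R = prune allV S
    -- A point set P' ⊊ R misses some v ∈ R.  The representative x of v
    -- survived pruning, so deleting ⟨x⟩_F from some T ⊇ R does not block;
    -- as P' avoids ⟨x⟩_F = ⟨v⟩_F, it lies in T minus ⟨x⟩_F and cannot block.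
    no-proper-blocking : ∀ P' → IsPointSet P' → (∀ v → P' v → member R v) → (∃ λ v → member R v × ¬ P' v) →
                         ¬ Blocking m P'
    no-proper-blocking P' P'-points P'⊆R (v , Rv , ¬P'v) =
      let (T , R⊆T , ¬T-x-blocks) = prune-survivor allV S x (allV-complete v) (member-resp R (≐-sym x≐v) Rv)
          P'⊆T-x : ∀ y → P' y → member (withoutPoint T x) y
          P'⊆T-x y P'y = R⊆T y (P'⊆R y P'y) ,
                         λ y∈x → ¬P'v (proj₁ P'-points _ _ x≐v (OnPoint-member P'-points y∈x P'y))
      in ¬T-x-blocks ∘ blocking-mono m P'⊆T-x
      where
      x = decode finiteV (encode finiteV v)
      x≐v = decode-encode finiteV v

module MinimalBlockingPreimage (q t' n' : ℕ) (1<q : 1 < q) {F K : Field}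
       (F↔ : Carrier F ↔ Fin q) (K↔ : Carrier K ↔ Fin (q ℕ.^ suc t')) (e : Embedding F K)
       (B : Geometry.V K (suc n') → Set) (B-minimal : Geometry.OverK.MinimalBlocking K (suc n') n' B) where
  t n m : ℕ
  t = suc t'
  n = suc n'
  m = n ℕ.* t ℕ.∸ t

  open Vectors K n
  open FiniteVectors K n K↔ using (𝓑?)
  private
    module LF = LinearF e
    module LK = LinearK

  B-points : LK.IsPointSet B
  B-points = proj₁ B-minimal

  m≡n't : m ≡ n' ℕ.* t
  m≡n't = ℕP.m+n∸m≡n t (n' ℕ.* t)

  tn≡t+m : t ℕ.* n ≡ t ℕ.+ m
  tn≡t+m = trans (ℕP.*-suc t n') (cong (t ℕ.+_) (trans (ℕP.*-comm t n') (sym m≡n't)))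

  open DecidableCore K n K↔ n' B B-points (proj₁ (proj₂ B-minimal))
  open MinimalSubset e n F↔ K↔ m

  core : DecidableSet
  core = record { member = Core ; member? = Core? ; member-resp = Core-resp }

  core-blocks : Blocks core
  core-blocks = HyperplanesBlockSubspaces.hyperplanes⇒subspaces q t' n' 1<q F↔ K↔ e m
                  (subst (m <_) (sym tn≡t+m) (ℕP.m<n+m m (s≤s z≤n))) (ℕP.≤-reflexive tn≡t+m)
                  Core Core-points Core-blocks

  B' : V → Set
  B' = member (prune allV core)

  B'-minimal : LF.MinimalBlocking m B'
  B'-minimal = minimal core (LF.K-points⇒F-points Core-points) core-blocks

  𝓑B'⊆B : ∀ v → 𝓑 B' v → B v
  𝓑B'⊆B = 𝓑-⊆ B-points (λ v → Core⊆B v ∘ prune-⊆ allV core v)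

  -- Field reduction with an F-basis of K: a hyperplane becomes an
  -- m-dimensional F-subspace, which B' meets.
  𝓑B'-blocks : LK.Blocking n' (𝓑 B')
  𝓑B'-blocks = FieldReduction.𝓑-blocks e n (proj₁ basis) (proj₁ (proj₂ basis)) n' (proj₁ B'-minimal)
                 (subst (λ k → LF.Blocking k B') m≡n't (proj₁ (proj₂ B'-minimal)))
    where open SubfieldBasis q t 1<q F↔ K↔ e using (basis)

  B⊆𝓑B' : ∀ v → B v → 𝓑 B' v
  B⊆𝓑B' v Bv = decidable-stable (𝓑? (member? (prune allV core)) v) λ v∉𝓑B' →
    proj₂ (proj₂ B-minimal) (𝓑 B') (𝓑-points (member-resp (prune allV core))) 𝓑B'⊆B (v , Bv , v∉𝓑B')
                            𝓑B'-blocks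

prime-power>1 : ∀ {q} → IsPrimePower q → 1 < q
prime-power>1 (p , k , p-prime , 1≤k , refl) =
  ℕP.^-monoʳ-< p (ℕ.nonTrivial⇒n>1 p {{prime⇒nonTrivial p-prime}}) 1≤k

-- The arithmetic operators of the statement (imported only here, so that
-- they do not clash with the field operations used above).
open import Data.Nat using (_^_; _*_; _∸_)

theorem8 : (q n t : ℕ) → IsPrimePower q → 1 ≤ n → 1 ≤ t
    → (F K : Field) → Carrier F ↔ Fin q → Carrier K ↔ Fin (q ^ t)
    → (e : Embedding F K)
    → (B : Geometry.V K n → Set)
    → Geometry.OverK.MinimalBlocking K n (n ∸ 1) B
    → Σ (Geometry.V K n → Set) λ B'
        → Geometry.OverF.MinimalBlocking K n F e (n * t ∸ t) B'
        × (∀ v → B v ⇔ Geometry.𝓑 K n B' v)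
theorem8 q zero     t        _    ()  _   F K F↔ K↔ e B B-minimal
theorem8 q (suc n') zero     _    _   ()  F K F↔ K↔ e B B-minimal
theorem8 q (suc n') (suc t') q-pp _   _   F K F↔ K↔ e B B-minimal =
  B' , B'-minimal , λ v → mk⇔ (B⊆𝓑B' v) (𝓑B'⊆B v)
  where open MinimalBlockingPreimage q t' n' (prime-power>1 q-pp) F↔ K↔ e B B-minimal
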